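{- For every permutation $w$, the closed interval poset $\overline{\mathcal{P}}(w)$ is a lattice.
   Context: For a permutation $w \in \mathfrak{S}_n$ in one-line notation $w(1)\cdots w(n)$, an interval of $w$ is a set of consecutive integers $[h,h+j]$ (possibly empty) such that $\{w(t) : t \in [i,i+j]\} = [h,h+j]$ for some $i$. The interval poset $\mathcal{P}(w)$ is the set of nonempty intervals of $w$ ordered by inclusion, and $\overline{\mathcal{P}}(w)$ is $\mathcal{P}(w)$ with a minimum element $\widehat{0}$ (the empty interval) adjoined. -}

module Defs where

open import Data.Nat using (ℕ; _≤_; _+_; _∸_)
open import Data.Fin using (Fin; toℕ)
open import Data.Fin.Permutation using (Permutation′; _⟨$⟩ʳ_)
open import Data.Product using (Σ; ∃; _×_)
open import Data.Maybe using (Maybe; just; nothing)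
open import Data.Unit using (⊤)
open import Data.Empty using (⊥)
open import Function.Bundles using (_⇔_)
open import Relation.Binary.PropositionalEquality using (_≡_)
open import Relation.Binary.Lattice.Definitions using (Supremum; Infimum)

-- Values of w are Fin n (0-indexed instead of 1-indexed; a harmless shift).
-- The value set [a,b] = {v | a ≤ v ≤ b}.
InValues : ∀ {n} → Fin n → Fin n → Fin n → Set
InValues a b v = toℕ a ≤ toℕ v × toℕ v ≤ toℕ b

IsIntervalOf : ∀ {n} → Permutation′ n → Fin n → Fin n → Set
IsIntervalOf {n} w a b =
  ∃ λ (i : Fin n) → ∀ (v : Fin n) →
    InValues a b v ⇔
      (∃ λ (t : Fin n) → (toℕ i ≤ toℕ t × toℕ t ≤ toℕ i + (toℕ b ∸ toℕ a))
                        × w ⟨$⟩ʳ t ≡ v)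

record NEInterval {n : ℕ} (w : Permutation′ n) : Set where
  constructor mkI
  field
    lo       : Fin n
    hi       : Fin n
    lo≤hi    : toℕ lo ≤ toℕ hi
    interval : IsIntervalOf w lo hi
open NEInterval public

_⊆I_ : ∀ {n} {w : Permutation′ n} → NEInterval w → NEInterval w → Set
I ⊆I J = ∀ v → InValues (lo I) (hi I) v → InValues (lo J) (hi J) v

-- Closed interval poset P̄(w): P(w) with 0̂ (the empty interval) adjoined;
-- nothing represents 0̂.
PBar : ∀ {n} → Permutation′ n → Set
PBar w = Maybe (NEInterval w)

_≤P_ : ∀ {n} {w : Permutation′ n} → PBar w → PBar w → Set
nothing ≤P _       = ⊤
just I  ≤P nothing = ⊥
just I  ≤P just J  = I ⊆I J

IsLattice : ∀ {A : Set} → (A → A → Set) → Set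
IsLattice {A} _≤_ =
  Σ (A → A → A) (Supremum _≤_) × Σ (A → A → A) (Infimum _≤_)

module Submission where

-- If w maps the position windows of two intervals onto their value ranges, then by injectivity it maps
-- the intersection of the windows onto the intersection of the ranges; a bijection between two sets of
-- consecutive integers forces them to have the same size, so the common values form an interval of w.
-- Thus P̄(w) has meets, 0̂ being the meet of disjoint intervals.  It is finite with a top element
-- ([1, n], or 0̂ itself when n = 0), so x ∨ y exists as the meet of all common upper bounds of x and y.

open import Defs
open import Algebra.Core using (Op₂)
import Algebra.Construct.NaturalChoice.Max as Max
import Algebra.Construct.NaturalChoice.Min as Min
open import Data.Empty using (⊥-elim)
open import Data.Fin as F using (Fin; toℕ; fromℕ; fromℕ<)
open import Data.Fin.Permutation using (Permutation′; _⟨$⟩ʳ_; _⟨$⟩ˡ_; inverseʳ)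
open import Data.Fin.Properties
  using (toℕ<n; toℕ-fromℕ<; fromℕ<-injective; toℕ-injective; injective⇒≤; ≤fromℕ; ¬Fin0; any?; all?; ≤-totalOrder)
  renaming (_≟_ to _≟ᶠ_)
open import Data.List using (List; []; _∷_; foldr; filter; map; cartesianProduct; allFin)
open import Data.List.Membership.Propositional using (_∈_)
open import Data.List.Membership.Propositional.Properties using (∈-filter⁺; ∈-map⁺; ∈-cartesianProduct⁺; ∈-allFin)
open import Data.List.Relation.Unary.All as All using (All; []; _∷_)
open import Data.List.Relation.Unary.All.Properties using (all-filter)
open import Data.List.Relation.Unary.Any using (here; there)
open import Data.Maybe using (just; nothing)
open import Data.Nat using (ℕ; zero; suc; z≤n; _≤_; _+_; _∸_; _⊓_; s≤s; s≤s⁻¹; _≤?_)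
open import Data.Nat.Properties
  using (≤-refl; ≤-trans; ≤-<-trans; ≤-reflexive; +-monoʳ-≤; m≤m+n; +-cancelˡ-≡; ∸-monoˡ-≤; ∸-cancelʳ-≡;
         m+[n∸m]≡n; m≤n⊓o⇒m≤n; m≤n⊓o⇒m≤o; ⊓-glb)
open import Data.Product using (∃; _×_; _,_; proj₁; proj₂)
open import Data.Unit using (tt)
open import Function using (_∘_; id)
open import Function.Bundles using (_⇔_; mk⇔; Equivalence; Injection)
open import Function.Definitions using (Injective)
open import Function.Properties.Inverse using (↔⇒↣)
open import Relation.Binary.Definitions using (Transitive; Decidable)
open import Relation.Binary.Lattice.Definitions using (Supremum; Infimum)
open import Relation.Binary.PropositionalEquality using (_≡_; refl; sym; trans; cong; subst; module ≡-Reasoning)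
open import Relation.Nullary using (Dec; yes; no)
open import Relation.Nullary.Decidable using (map′; _×-dec_; _→-dec_)

open Equivalence using (to; from)

_⇔-dec_ : ∀ {A B : Set} → Dec A → Dec B → Dec (A ⇔ B)
A? ⇔-dec B? = map′ (λ (f , g) → mk⇔ f g) (λ A⇔B → to A⇔B , from A⇔B) ((A? →-dec B?) ×-dec (B? →-dec A?))

module FiniteMeetSemilattice
  {A : Set} {_≤ᴬ_ : A → A → Set} (≤ᴬ-trans : Transitive _≤ᴬ_) (_≤ᴬ?_ : Decidable _≤ᴬ_)
  {⊤ : A} (≤⊤ : ∀ x → x ≤ᴬ ⊤) {_∧_ : Op₂ A} (∧-infimum : Infimum _≤ᴬ_ _∧_)
  (elements : List A) (elements-complete : ∀ x → ∃ λ y → y ∈ elements × x ≤ᴬ y × y ≤ᴬ x)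
  where

  ⋀ : List A → A
  ⋀ = foldr _∧_ ⊤

  ⋀-lowerBound : ∀ {x xs} → x ∈ xs → ⋀ xs ≤ᴬ x
  ⋀-lowerBound (here refl) = proj₁ (∧-infimum _ _)
  ⋀-lowerBound (there x∈xs) = ≤ᴬ-trans (proj₁ (proj₂ (∧-infimum _ _))) (⋀-lowerBound x∈xs)

  ⋀-greatest : ∀ {x xs} → All (x ≤ᴬ_) xs → x ≤ᴬ ⋀ xs
  ⋀-greatest [] = ≤⊤ _
  ⋀-greatest (x≤y ∷ x≤ys) = proj₂ (proj₂ (∧-infimum _ _)) _ x≤y (⋀-greatest x≤ys)

  upperBounds : A → A → List A
  upperBounds x y = filter (λ z → (x ≤ᴬ? z) ×-dec (y ≤ᴬ? z)) elements

  _∨_ : Op₂ A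
  x ∨ y = ⋀ (upperBounds x y)

  ∨-supremum : Supremum _≤ᴬ_ _∨_
  ∨-supremum x y =
    ⋀-greatest (All.map proj₁ bounded) , ⋀-greatest (All.map proj₂ bounded) , least
    where
    bounded : All (λ z → x ≤ᴬ z × y ≤ᴬ z) (upperBounds x y)
    bounded = all-filter (λ z → (x ≤ᴬ? z) ×-dec (y ≤ᴬ? z)) elements

    least : ∀ z → x ≤ᴬ z → y ≤ᴬ z → (x ∨ y) ≤ᴬ z
    least z x≤z y≤z with elements-complete z
    ... | z′ , z′∈ , z≤z′ , z′≤z =
      ≤ᴬ-trans (⋀-lowerBound (∈-filter⁺ _ z′∈ (≤ᴬ-trans x≤z z≤z′ , ≤ᴬ-trans y≤z z≤z′))) z′≤z

module _ {n : ℕ} {lo hi : Fin n} (lo≤hi : lo F.≤ hi) where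

  private
    lo+k≤hi : (k : Fin (suc (toℕ hi ∸ toℕ lo))) → toℕ lo + toℕ k ≤ toℕ hi
    lo+k≤hi k = ≤-trans (+-monoʳ-≤ (toℕ lo) (s≤s⁻¹ (toℕ<n k))) (≤-reflexive (m+[n∸m]≡n lo≤hi))

  enumerateRange : Fin (suc (toℕ hi ∸ toℕ lo)) → Fin n
  enumerateRange k = fromℕ< (≤-<-trans (lo+k≤hi k) (toℕ<n hi))

  enumerateRange-bounds : ∀ k → lo F.≤ enumerateRange k × enumerateRange k F.≤ hi
  enumerateRange-bounds k rewrite toℕ-fromℕ< (≤-<-trans (lo+k≤hi k) (toℕ<n hi)) =
    m≤m+n (toℕ lo) (toℕ k) , lo+k≤hi k

  enumerateRange-injective : Injective _≡_ _≡_ enumerateRange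
  enumerateRange-injective eq =
    toℕ-injective (+-cancelˡ-≡ (toℕ lo) _ _ (fromℕ<-injective _ _ _ _ eq))

injective-into-range⇒≤ : ∀ {K m M} (f : Fin (suc K) → ℕ) →
  (∀ k → m ≤ f k × f k ≤ M) → Injective _≡_ _≡_ f → K ≤ M ∸ m
injective-into-range⇒≤ {K} {m} {M} f range f-injective = s≤s⁻¹ (injective⇒≤ g-injective)
  where
  g : Fin (suc K) → Fin (suc (M ∸ m))
  g k = fromℕ< (s≤s (∸-monoˡ-≤ m (proj₂ (range k))))

  g-injective : Injective _≡_ _≡_ g
  g-injective {k} {k′} eq =
    f-injective (∸-cancelʳ-≡ (proj₁ (range k)) (proj₁ (range k′)) (fromℕ<-injective _ _ _ _ eq))

module _ {n : ℕ} (w : Permutation′ n) where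

  open Max (≤-totalOrder n) using ()
    renaming (_⊔_ to _⊔ᶠ_; ⊔-lub to ⊔ᶠ-lub; x≤x⊔y to x≤x⊔ᶠy; x≤y⊔x to x≤y⊔ᶠx;
              x⊔y≤z⇒x≤z to x⊔ᶠy≤z⇒x≤z; x⊔y≤z⇒y≤z to x⊔ᶠy≤z⇒y≤z)
  open Min (≤-totalOrder n) using ()
    renaming (_⊓_ to _⊓ᶠ_; ⊓-glb to ⊓ᶠ-glb; x⊓y≤x to x⊓ᶠy≤x; x⊓y≤y to x⊓ᶠy≤y;
              x≤y⊓z⇒x≤y to x≤y⊓ᶠz⇒x≤y; x≤y⊓z⇒x≤z to x≤y⊓ᶠz⇒x≤z)

  w-injective : Injective _≡_ _≡_ (w ⟨$⟩ʳ_)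
  w-injective = Injection.injective (↔⇒↣ w)

  -- IsIntervalOf w a b is ∃ i. MapsWindowOnto i (i + (b − a)) a b.  Intersecting windows forgets
  -- that the length is b − a; mapsWindowOnto⇒interval recovers it by counting.
  MapsWindowOnto : Fin n → ℕ → Fin n → Fin n → Set
  MapsWindowOnto i q a b =
    ∀ v → InValues a b v ⇔ ∃ λ t → (toℕ i ≤ toℕ t × toℕ t ≤ q) × w ⟨$⟩ʳ t ≡ v


  mapsWindowOnto-∩ : ∀ {i q a b i′ q′ a′ b′} →
    MapsWindowOnto i q a b → MapsWindowOnto i′ q′ a′ b′ →
    MapsWindowOnto (i ⊔ᶠ i′) (q ⊓ q′) (a ⊔ᶠ a′) (b ⊓ᶠ b′)
  mapsWindowOnto-∩ {i} {q} {a} {b} {i′} {q′} {a′} {b′} maps maps′ v = mk⇔ into onto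
    where
    Preimage : Set
    Preimage = ∃ λ t → (toℕ (i ⊔ᶠ i′) ≤ toℕ t × toℕ t ≤ q ⊓ q′) × w ⟨$⟩ʳ t ≡ v

    into : InValues (a ⊔ᶠ a′) (b ⊓ᶠ b′) v → Preimage
    into (a⊔a′≤v , v≤b⊓b′)
      with to (maps v) (x⊔ᶠy≤z⇒x≤z a a′ a⊔a′≤v , x≤y⊓ᶠz⇒x≤y b b′ v≤b⊓b′)
         | to (maps′ v) (x⊔ᶠy≤z⇒y≤z a a′ a⊔a′≤v , x≤y⊓ᶠz⇒x≤z b b′ v≤b⊓b′)
    ... | t , (i≤t , t≤q) , wt≡v | t′ , (i′≤t′ , t′≤q′) , wt′≡v
      with refl ← w-injective (trans wt≡v (sym wt′≡v)) =
      t , (⊔ᶠ-lub i≤t i′≤t′ , ⊓-glb t≤q t′≤q′) , wt≡v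

    onto : Preimage → InValues (a ⊔ᶠ a′) (b ⊓ᶠ b′) v
    onto (t , (i⊔i′≤t , t≤q⊓q′) , wt≡v)
      with a≤v , v≤b ← from (maps v)
                          (t , (x⊔ᶠy≤z⇒x≤z i i′ i⊔i′≤t , m≤n⊓o⇒m≤n q q′ t≤q⊓q′) , wt≡v)
         | a′≤v , v≤b′ ← from (maps′ v)
                          (t , (x⊔ᶠy≤z⇒y≤z i i′ i⊔i′≤t , m≤n⊓o⇒m≤o q q′ t≤q⊓q′) , wt≡v) =
      ⊔ᶠ-lub a≤v a′≤v , ⊓ᶠ-glb v≤b v≤b′

  module _ {i q a b} (maps : MapsWindowOnto i q a b) (a≤b : a F.≤ b) where

    length≤window : toℕ b ∸ toℕ a ≤ q ∸ toℕ i
    length≤window = injective-into-range⇒≤ (toℕ ∘ position) position-range position-injective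
      where
      preimage : ∀ k → ∃ λ t → (toℕ i ≤ toℕ t × toℕ t ≤ q) × w ⟨$⟩ʳ t ≡ enumerateRange a≤b k
      preimage k = to (maps _) (enumerateRange-bounds a≤b k)

      position : Fin (suc (toℕ b ∸ toℕ a)) → Fin n
      position k = proj₁ (preimage k)

      position-range : ∀ k → toℕ i ≤ toℕ (position k) × toℕ (position k) ≤ q
      position-range k = proj₁ (proj₂ (preimage k))

      position-injective : Injective _≡_ _≡_ (toℕ ∘ position)
      position-injective {k} {k′} eq = enumerateRange-injective a≤b (begin
        enumerateRange a≤b k   ≡⟨ sym (proj₂ (proj₂ (preimage k))) ⟩
        w ⟨$⟩ʳ position k      ≡⟨ cong (w ⟨$⟩ʳ_) (toℕ-injective eq) ⟩
        w ⟨$⟩ʳ position k′     ≡⟨ proj₂ (proj₂ (preimage k′)) ⟩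
        enumerateRange a≤b k′  ∎)
        where open ≡-Reasoning

    window≤length : ∀ {t} → i F.≤ t → toℕ t ≤ q → toℕ t ∸ toℕ i ≤ toℕ b ∸ toℕ a
    window≤length {t} i≤t t≤q = injective-into-range⇒≤ (toℕ ∘ value) value-range value-injective
      where
      value : Fin (suc (toℕ t ∸ toℕ i)) → Fin n
      value k = w ⟨$⟩ʳ enumerateRange i≤t k

      value-range : ∀ k → toℕ a ≤ toℕ (value k) × toℕ (value k) ≤ toℕ b
      value-range k with i≤s , s≤t ← enumerateRange-bounds i≤t k =
        from (maps (value k)) (enumerateRange i≤t k , (i≤s , ≤-trans s≤t t≤q) , refl)

      value-injective : Injective _≡_ _≡_ (toℕ ∘ value)
      value-injective = enumerateRange-injective i≤t ∘ w-injective ∘ toℕ-injective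

    i≤q : toℕ i ≤ q
    i≤q with _ , (i≤t , t≤q) , _ ← to (maps a) (≤-refl , a≤b) = ≤-trans i≤t t≤q

    mapsWindowOnto⇒interval : IsIntervalOf w a b
    mapsWindowOnto⇒interval = i , λ v → mk⇔
      (λ v∈ab → let (t , (i≤t , t≤q) , wt≡v) = to (maps v) v∈ab in t , (i≤t , shrink i≤t t≤q) , wt≡v)
      (λ (t , (i≤t , t≤i+ℓ) , wt≡v) → from (maps v) (t , (i≤t , grow t≤i+ℓ) , wt≡v))
      where
      shrink : ∀ {t} → i F.≤ t → toℕ t ≤ q → toℕ t ≤ toℕ i + (toℕ b ∸ toℕ a)
      shrink {t} i≤t t≤q = subst (_≤ toℕ i + (toℕ b ∸ toℕ a)) (m+[n∸m]≡n i≤t)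
        (+-monoʳ-≤ (toℕ i) (window≤length i≤t t≤q))

      grow : ∀ {t} → t ≤ toℕ i + (toℕ b ∸ toℕ a) → t ≤ q
      grow t≤i+ℓ = ≤-trans t≤i+ℓ (subst (toℕ i + (toℕ b ∸ toℕ a) ≤_) (m+[n∸m]≡n i≤q)
        (+-monoʳ-≤ (toℕ i) length≤window))

  ⊆I⇔bounds : ∀ (I J : NEInterval w) → I ⊆I J ⇔ (lo J F.≤ lo I × hi I F.≤ hi J)
  ⊆I⇔bounds I J = mk⇔
    (λ I⊆J → proj₁ (I⊆J (lo I) (≤-refl , lo≤hi I)) , proj₂ (I⊆J (hi I) (lo≤hi I , ≤-refl)))
    (λ (loJ≤loI , hiI≤hiJ) _ (loI≤v , v≤hiI) → ≤-trans loJ≤loI loI≤v , ≤-trans v≤hiI hiI≤hiJ)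

  ≤P-trans : Transitive (_≤P_ {w = w})
  ≤P-trans {nothing} _ _ = tt
  ≤P-trans {just I} {just J} {just K} I⊆J J⊆K v = J⊆K v ∘ I⊆J v

  _≤P?_ : Decidable (_≤P_ {w = w})
  nothing ≤P? _ = yes tt
  just I ≤P? nothing = no λ ()
  just I ≤P? just J =
    map′ (from (⊆I⇔bounds I J)) (to (⊆I⇔bounds I J)) ((lo J F.≤? lo I) ×-dec (hi I F.≤? hi J))

  Overlapping : NEInterval w → NEInterval w → Set
  Overlapping I J = lo I ⊔ᶠ lo J F.≤ hi I ⊓ᶠ hi J

  intersection : (I J : NEInterval w) → Overlapping I J → NEInterval w
  intersection I J overlapping = mkI (lo I ⊔ᶠ lo J) (hi I ⊓ᶠ hi J) overlapping
    (mapsWindowOnto⇒interval (mapsWindowOnto-∩ (proj₂ (interval I)) (proj₂ (interval J))) overlapping)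

  module _ {I J : NEInterval w} where

    intersection-⊆ˡ : (overlapping : Overlapping I J) → intersection I J overlapping ⊆I I
    intersection-⊆ˡ overlapping = from (⊆I⇔bounds (intersection I J overlapping) I)
      (x≤x⊔ᶠy (lo I) (lo J) , x⊓ᶠy≤x (hi I) (hi J))

    intersection-⊆ʳ : (overlapping : Overlapping I J) → intersection I J overlapping ⊆I J
    intersection-⊆ʳ overlapping = from (⊆I⇔bounds (intersection I J overlapping) J)
      (x≤y⊔ᶠx (lo I) (lo J) , x⊓ᶠy≤y (hi I) (hi J))

    lowerBound⇒bounds : ∀ {K} → K ⊆I I → K ⊆I J → lo I ⊔ᶠ lo J F.≤ lo K × hi K F.≤ hi I ⊓ᶠ hi J
    lowerBound⇒bounds {K} K⊆I K⊆J
      with loI≤loK , hiK≤hiI ← to (⊆I⇔bounds K I) K⊆I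
         | loJ≤loK , hiK≤hiJ ← to (⊆I⇔bounds K J) K⊆J =
      ⊔ᶠ-lub loI≤loK loJ≤loK , ⊓ᶠ-glb hiK≤hiI hiK≤hiJ

    lowerBound⇒overlapping : ∀ {K} → K ⊆I I → K ⊆I J → Overlapping I J
    lowerBound⇒overlapping {K} K⊆I K⊆J with lo≤loK , hiK≤hi ← lowerBound⇒bounds {K} K⊆I K⊆J =
      ≤-trans lo≤loK (≤-trans (lo≤hi K) hiK≤hi)

    intersection-greatest : ∀ {K} (overlapping : Overlapping I J) →
      K ⊆I I → K ⊆I J → K ⊆I intersection I J overlapping
    intersection-greatest {K} overlapping K⊆I K⊆J =
      from (⊆I⇔bounds K (intersection I J overlapping)) (lowerBound⇒bounds {K} K⊆I K⊆J)

  overlapping? : ∀ I J → Dec (Overlapping I J)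
  overlapping? I J = lo I ⊔ᶠ lo J F.≤? hi I ⊓ᶠ hi J

  intersectionOrEmpty : (I J : NEInterval w) → Dec (Overlapping I J) → PBar w
  intersectionOrEmpty I J (yes overlapping) = just (intersection I J overlapping)
  intersectionOrEmpty I J (no _) = nothing

  _∧_ : Op₂ (PBar w)
  nothing ∧ _ = nothing
  just _ ∧ nothing = nothing
  just I ∧ just J = intersectionOrEmpty I J (overlapping? I J)

  ∧-infimum : Infimum _≤P_ _∧_
  ∧-infimum nothing _ = tt , tt , λ _ z≤nothing _ → z≤nothing
  ∧-infimum (just _) nothing = tt , tt , λ _ _ z≤nothing → z≤nothing
  ∧-infimum (just I) (just J) = infimum (overlapping? I J)
    where
    infimum : ∀ d → let m = intersectionOrEmpty I J d in
      m ≤P just I × m ≤P just J × ∀ z → z ≤P just I → z ≤P just J → z ≤P m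
    infimum (yes overlapping) =
      intersection-⊆ˡ {I} {J} overlapping , intersection-⊆ʳ {I} {J} overlapping , greatest
      where
      greatest : ∀ z → z ≤P just I → z ≤P just J → z ≤P just (intersection I J overlapping)
      greatest nothing _ _ = tt
      greatest (just K) = intersection-greatest {I} {J} {K} overlapping
    infimum (no disjoint) = tt , tt , greatest
      where
      greatest : ∀ z → z ≤P just I → z ≤P just J → z ≤P nothing
      greatest nothing _ _ = tt
      greatest (just K) K⊆I K⊆J = disjoint (lowerBound⇒overlapping {I} {J} {K} K⊆I K⊆J)

  isInterval? : ∀ a b → Dec (IsIntervalOf w a b)
  isInterval? a b = any? λ i → all? λ v →
    ((toℕ a ≤? toℕ v) ×-dec (toℕ v ≤? toℕ b)) ⇔-dec
    any? λ t → ((toℕ i ≤? toℕ t) ×-dec (toℕ t ≤? toℕ i + (toℕ b ∸ toℕ a))) ×-dec (w ⟨$⟩ʳ t ≟ᶠ v)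

  intervalOn : Fin n × Fin n → PBar w
  intervalOn (a , b) with a F.≤? b | isInterval? a b
  ... | yes a≤b | yes isInterval = just (mkI a b a≤b isInterval)
  ... | _       | _              = nothing

  intervalOn-bounds : ∀ K → just K ≤P intervalOn (lo K , hi K) × intervalOn (lo K , hi K) ≤P just K
  intervalOn-bounds K with lo K F.≤? hi K | isInterval? (lo K) (hi K)
  ... | yes _    | yes _        = (λ _ → id) , (λ _ → id)
  ... | no lo≰hi | _            = ⊥-elim (lo≰hi (lo≤hi K))
  ... | yes _    | no ¬interval = ⊥-elim (¬interval (interval K))

  candidates : List (PBar w)
  candidates = nothing ∷ map intervalOn (cartesianProduct (allFin n) (allFin n))

  candidates-complete : ∀ x → ∃ λ y → y ∈ candidates × x ≤P y × y ≤P x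
  candidates-complete nothing = nothing , here refl , tt , tt
  candidates-complete (just K) =
    intervalOn (lo K , hi K) ,
    there (∈-map⁺ intervalOn (∈-cartesianProduct⁺ (∈-allFin (lo K)) (∈-allFin (hi K)))) ,
    intervalOn-bounds K

whole : ∀ {k} (w : Permutation′ (suc k)) → NEInterval w
whole {k} w = mkI F.zero (fromℕ k) z≤n (F.zero , λ v → mk⇔
  (λ _ → w ⟨$⟩ˡ v , (z≤n , ≤fromℕ (w ⟨$⟩ˡ v)) , inverseʳ w)
  (λ _ → z≤n , ≤fromℕ v))

top : ∀ {n} (w : Permutation′ n) → PBar w
top {zero} _ = nothing
top {suc _} w = just (whole w)

≤top : ∀ {n} {w : Permutation′ n} x → x ≤P top w
≤top nothing = tt
≤top {zero} (just I) = ⊥-elim (¬Fin0 (lo I))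
≤top {suc _} (just I) v _ = z≤n , ≤fromℕ v

theorem3p3 : ∀ (n : ℕ) (w : Permutation′ n) → IsLattice (_≤P_ {n} {w})
theorem3p3 n w = (_∨_ , ∨-supremum) , (_∧_ w , ∧-infimum w)
  where
  open FiniteMeetSemilattice
    (≤P-trans w) (_≤P?_ w) ≤top (∧-infimum w) (candidates w) (candidates-complete w)
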